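{- Let $0\le m\le n$, $\lambda=2^m1^{n-m}$, and let $c_1,\dots,c_n$ be nonnegative integers. Then there exists a (unique) standard Young tableau $T$ of shape $\lambda$ whose first-column entries $a_1,\dots,a_n$ (top to bottom) satisfy $\operatorname{dep}(a_i)=c_i$ for all $1\le i\le n$ if and only if $c_1=0$, $c_i\le c_{i-1}+1$ for all $i>1$, and $c_i\ge i-m-1$ for all $i>m$.
   Context: $\lambda=2^m1^{n-m}$ is the shape with $m$ rows of length $2$ followed by $n-m$ rows of length $1$. A standard Young tableau is a filling by $1,\dots,n+m$ increasing along rows and down columns. For an entry $a$ in column $j$, $\operatorname{dep}(a)$ is the number of entries of column $j$ smaller than $a$ minus the number of entries of column $j+1$ smaller than $a$ (the latter $0$ if there is no column $j+1$). -}

module Defs where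

open import Data.Nat using (ℕ; zero; suc; _+_; _∸_; _≤_; _<_; _<?_)
open import Data.Fin using (Fin; toℕ; inject≤) renaming (zero to fzero; suc to fsuc)
open import Data.Integer using (ℤ; +_; _-_)
open import Relation.Nullary using (yes; no; ¬_)
open import Relation.Binary.PropositionalEquality using (_≡_)
open import Data.Product using (_×_)

-- A standard Young tableau of shape λ = 2^m 1^(n-m) (m ≤ n), given by its columns:
--   col₁ i  = entry in row i+1 of the first column  (i < n)
--   col₂ j  = entry in row j+1 of the second column (j < m)
-- The entries are exactly 1,…,n+m, each used once (all in range, pairwise distinct,
-- and there are n+m cells), increasing along rows and strictly down columns.
record SYT (n m : ℕ) (m≤n : m ≤ n) : Set where
  field
    col₁ : Fin n → ℕ
    col₂ : Fin m → ℕ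
    col₁-range : ∀ i → 1 ≤ col₁ i × col₁ i ≤ n + m
    col₂-range : ∀ j → 1 ≤ col₂ j × col₂ j ≤ n + m
    col₁-incr  : ∀ i i′ → toℕ i < toℕ i′ → col₁ i < col₁ i′
    col₂-incr  : ∀ j j′ → toℕ j < toℕ j′ → col₂ j < col₂ j′
    rows-incr  : ∀ j → col₁ (inject≤ j m≤n) < col₂ j
    disjoint   : ∀ i j → ¬ (col₁ i ≡ col₂ j)
open SYT public

countBelow : (len : ℕ) → (Fin len → ℕ) → ℕ → ℕ
countBelow zero    f a = 0
countBelow (suc l) f a with f fzero <? a
... | yes _ = suc (countBelow l (λ k → f (fsuc k)) a)
... | no  _ = countBelow l (λ k → f (fsuc k)) a

-- dep(a) for an entry a of the first column (column j = 1, column j+1 = 2):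
-- (# entries of column 1 smaller than a) − (# entries of column 2 smaller than a)
dep₁ : ∀ {n m m≤n} → SYT n m m≤n → ℕ → ℤ
dep₁ {n} {m} T a = + countBelow n (col₁ T) a - + countBelow m (col₂ T) a

-- Write a_i for the i-th first-column entry (counting from 0) and s_i for the number of
-- second-column entries below a_i.  As the first column increases, dep(a_i) = i - s_i; as the
-- entries are exactly 1,…,n+m, a_i = 1 + i + s_i.  So a tableau with depths c has s_i = i - c_i,
-- which fixes the first column, and the second column is then the complement.  The conditions on
-- c say precisely that s is nondecreasing with s_i ≤ i and s_i ≤ m, and any such s is realised by
-- a_i = 1 + i + s_i and b_j = 1 + j + #{i | s_i ≤ j}.
module Submission where

open import Defs
open import Algebra.Bundles using (AbelianGroup)
open import Data.Nat using (ℕ; zero; suc; _+_; _∸_; _≤_; _<_; _<?_; _≤?_; _≟_; z≤n; s≤s; s≤s⁻¹; z<s)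
open import Data.Nat.Properties
open import Data.Fin using (Fin; toℕ; inject₁; inject≤) renaming (zero to fzero; suc to fsuc)
open import Data.Fin.Induction using (<-weakInduction)
open import Data.Fin.Properties using (toℕ<n; toℕ-injective; toℕ-inject₁; toℕ-inject≤)
open import Data.Integer as ℤ using (+_)
open import Data.Integer.Properties using (+-0-abelianGroup; pos-+; +-injective)
open import Data.Product using (_×_; _,_; ∃; proj₁; proj₂)
open import Data.Sum using (inj₁; inj₂)
open import Function.Base using (_∘_)
open import Function.Bundles using (_⇔_; mk⇔; Equivalence)
open import Relation.Nullary using (yes; no)
open import Relation.Nullary.Negation using (contradiction)
open import Relation.Binary.PropositionalEquality
open import Algebra.Properties.CommutativeSemigroup +-commutativeSemigroup using (interchange)
open import Algebra.Properties.Group (AbelianGroup.group +-0-abelianGroup)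
  using (//-rightDividesˡ; //-rightDividesʳ)

StrictlyIncreasing : (l : ℕ) → (Fin l → ℕ) → Set
StrictlyIncreasing l f = ∀ i i′ → toℕ i < toℕ i′ → f i < f i′

strictlyIncreasing-tail : ∀ {l} {f : Fin (suc l) → ℕ} →
  StrictlyIncreasing (suc l) f → StrictlyIncreasing l (f ∘ fsuc)
strictlyIncreasing-tail f-incr i i′ i<i′ = f-incr (fsuc i) (fsuc i′) (s≤s i<i′)

strictlyIncreasing⇒monotone : ∀ {l} {f : Fin l → ℕ} →
  StrictlyIncreasing l f → ∀ i k → toℕ i ≤ toℕ k → f i ≤ f k
strictlyIncreasing⇒monotone f-incr i k i≤k with m≤n⇒m<n∨m≡n i≤k
... | inj₁ i<k = <⇒≤ (f-incr i k i<k)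
... | inj₂ i≡k = ≤-reflexive (cong _ (toℕ-injective i≡k))

consecutive-induction : ∀ {n} (P : Fin n → Set) →
  (∀ i → toℕ i ≡ 0 → P i) → (∀ i j → toℕ j ≡ suc (toℕ i) → P i → P j) → ∀ i → P i
consecutive-induction {suc n} P base step =
  <-weakInduction P (base fzero refl) (λ i → step (inject₁ i) (fsuc i) (cong suc (sym (toℕ-inject₁ i))))

consecutive-mono⇒mono : ∀ {n} (f : Fin n → ℕ) →
  (∀ i j → toℕ j ≡ suc (toℕ i) → f i ≤ f j) → ∀ i j → toℕ i ≤ toℕ j → f i ≤ f j
consecutive-mono⇒mono f f-step i j = consecutive-induction P base step j i
  where
  P : _ → Set
  P j = ∀ i → toℕ i ≤ toℕ j → f i ≤ f j
  base : ∀ j → toℕ j ≡ 0 → P j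
  base j j≡0 i i≤j =
    ≤-reflexive (cong f (toℕ-injective (trans (n≤0⇒n≡0 (subst (toℕ i ≤_) j≡0 i≤j)) (sym j≡0))))
  step : ∀ i j → toℕ j ≡ suc (toℕ i) → P i → P j
  step i j j≡1+i ih k k≤j with m≤n⇒m<n∨m≡n k≤j
  ... | inj₁ k<j = ≤-trans (ih k (s≤s⁻¹ (subst (toℕ k <_) j≡1+i k<j))) (f-step i j j≡1+i)
  ... | inj₂ k≡j = ≤-reflexive (cong f (toℕ-injective k≡j))

countBelow≤length : ∀ l f a → countBelow l f a ≤ l
countBelow≤length zero    f a = z≤n
countBelow≤length (suc l) f a with f fzero <? a
... | yes _ = s≤s (countBelow≤length l _ a)
... | no  _ = m≤n⇒m≤1+n (countBelow≤length l _ a)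

countBelow-monoʳ : ∀ l f {a b} → a ≤ b → countBelow l f a ≤ countBelow l f b
countBelow-monoʳ zero    f a≤b = z≤n
countBelow-monoʳ (suc l) f {a} {b} a≤b with f fzero <? a | f fzero <? b
... | yes _    | yes _    = s≤s (countBelow-monoʳ l _ a≤b)
... | yes f0<a | no  f0≮b = contradiction (<-≤-trans f0<a a≤b) f0≮b
... | no  _    | yes _    = m≤n⇒m≤1+n (countBelow-monoʳ l _ a≤b)
... | no  _    | no  _    = countBelow-monoʳ l _ a≤b

countBelow≤ : ∀ l f a t → (∀ k → t ≤ toℕ k → a ≤ f k) → countBelow l f a ≤ t
countBelow≤ zero    f a t above = z≤n
countBelow≤ (suc l) f a t above with f fzero <? a
countBelow≤ (suc l) f a zero    above | yes f0<a = contradiction (above fzero z≤n) (<⇒≱ f0<a)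
countBelow≤ (suc l) f a (suc t) above | yes _ =
  s≤s (countBelow≤ l _ a t (λ k t≤k → above (fsuc k) (s≤s t≤k)))
... | no _ = countBelow≤ l _ a t (λ k t≤k → above (fsuc k) (m≤n⇒m≤1+n t≤k))

≤countBelow : ∀ l f a t → t ≤ l → (∀ k → toℕ k < t → f k < a) → t ≤ countBelow l f a
≤countBelow l       f a zero    t≤l below = z≤n
≤countBelow (suc l) f a (suc t) t≤l below with f fzero <? a
... | yes _    = s≤s (≤countBelow l _ a t (s≤s⁻¹ t≤l) (λ k k<t → below (fsuc k) (s≤s k<t)))
... | no  f0≮a = contradiction (below fzero z<s) f0≮a

countBelow≡ : ∀ l f a t → t ≤ l →
  (∀ k → toℕ k < t → f k < a) → (∀ k → t ≤ toℕ k → a ≤ f k) → countBelow l f a ≡ t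
countBelow≡ l f a t t≤l below above =
  ≤-antisym (countBelow≤ l f a t above) (≤countBelow l f a t t≤l below)

countBelow≡length : ∀ l f a → (∀ k → f k < a) → countBelow l f a ≡ l
countBelow≡length l f a below =
  countBelow≡ l f a l ≤-refl (λ k _ → below k) (λ k l≤k → contradiction (toℕ<n k) (≤⇒≯ l≤k))

countBelow-cong : ∀ l {f g} a → (∀ k → f k ≡ g k) → countBelow l f a ≡ countBelow l g a
countBelow-cong zero    a f≗g = refl
countBelow-cong (suc l) {f} {g} a f≗g with f fzero <? a | g fzero <? a
... | yes _    | yes _    = cong suc (countBelow-cong l a (f≗g ∘ fsuc))
... | yes f0<a | no  g0≮a = contradiction (subst (_< a) (f≗g fzero) f0<a) g0≮a
... | no  f0≮a | yes g0<a = contradiction (subst (_< a) (sym (f≗g fzero)) g0<a) f0≮a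
... | no  _    | no  _    = countBelow-cong l a (f≗g ∘ fsuc)

countBelow-rank : ∀ l f → StrictlyIncreasing l f → ∀ i → countBelow l f (f i) ≡ toℕ i
countBelow-rank l f f-incr i = countBelow≡ l f (f i) (toℕ i) (<⇒≤ (toℕ<n i))
  (λ k k<i → f-incr k i k<i) (λ k i≤k → strictlyIncreasing⇒monotone f-incr i k i≤k)

countBelow-suc-rank : ∀ l f → StrictlyIncreasing l f → ∀ i → countBelow l f (suc (f i)) ≡ suc (toℕ i)
countBelow-suc-rank l f f-incr i = countBelow≡ l f (suc (f i)) (suc (toℕ i)) (toℕ<n i)
  (λ k k<1+i → s≤s (strictlyIncreasing⇒monotone f-incr k i (s≤s⁻¹ k<1+i))) (λ k i<k → f-incr i k i<k)

countEqual : (l : ℕ) → (Fin l → ℕ) → ℕ → ℕ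
countEqual zero    f a = 0
countEqual (suc l) f a with f fzero ≟ a
... | yes _ = suc (countEqual l (f ∘ fsuc) a)
... | no  _ = countEqual l (f ∘ fsuc) a

countBelow-suc : ∀ l f a → countBelow l f (suc a) ≡ countBelow l f a + countEqual l f a
countBelow-suc zero    f a = refl
countBelow-suc (suc l) f a with f fzero <? suc a | f fzero <? a | f fzero ≟ a
... | yes _     | yes f0<a | yes f0≡a = contradiction f0≡a (<⇒≢ f0<a)
... | yes _     | yes _    | no  _    = cong suc (countBelow-suc l _ a)
... | yes _     | no  _    | yes _    = trans (cong suc (countBelow-suc l _ a)) (sym (+-suc _ _))
... | yes f0≤a  | no  f0≮a | no  f0≢a = contradiction (≤∧≢⇒< (s≤s⁻¹ f0≤a) f0≢a) f0≮a
... | no  f0≰a  | yes f0<a | _        = contradiction (m<n⇒m<1+n f0<a) f0≰a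
... | no  f0≰a  | no  _    | yes f0≡a = contradiction (s≤s (≤-reflexive f0≡a)) f0≰a
... | no  _     | no  _    | no  _    = countBelow-suc l _ a

countEqual≡0 : ∀ l f a → (∀ k → f k ≢ a) → countEqual l f a ≡ 0
countEqual≡0 zero    f a misses = refl
countEqual≡0 (suc l) f a misses with f fzero ≟ a
... | yes f0≡a = contradiction f0≡a (misses fzero)
... | no  _    = countEqual≡0 l _ a (misses ∘ fsuc)

countEqual-witness : ∀ l f a → 0 < countEqual l f a → ∃ λ k → f k ≡ a
countEqual-witness (suc l) f a hit with f fzero ≟ a
... | yes f0≡a = fzero , f0≡a
... | no  _ with countEqual-witness l _ a hit
...   | k , fk≡a = fsuc k , fk≡a

countEqual≤1 : ∀ l f → StrictlyIncreasing l f → ∀ a → countEqual l f a ≤ 1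
countEqual≤1 zero    f f-incr a = z≤n
countEqual≤1 (suc l) f f-incr a with f fzero ≟ a
... | yes f0≡a = s≤s (≤-reflexive (countEqual≡0 l _ a
      (λ k fk≡a → <⇒≢ (f-incr fzero (fsuc k) z<s) (trans f0≡a (sym fk≡a)))))
... | no  _    = countEqual≤1 l _ (strictlyIncreasing-tail f-incr) a

rank⇒≡ : ∀ l f → StrictlyIncreasing l f → ∀ j x →
  countBelow l f x ≡ toℕ j → countBelow l f (suc x) ≡ suc (toℕ j) → f j ≡ x
rank⇒≡ l f f-incr j x below below′ =
  let (k , fk≡x) = countEqual-witness l f x (subst (0 <_) (sym hitsOnce) z<s)
      k≡j = toℕ-injective (trans (sym (countBelow-rank l f f-incr k))
                                 (trans (cong (countBelow l f) fk≡x) below))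
  in subst (λ k → f k ≡ x) k≡j fk≡x
  where
  open ≡-Reasoning
  hitsOnce : countEqual l f x ≡ 1
  hitsOnce = +-cancelˡ-≡ (toℕ j) _ _ (begin
    toℕ j + countEqual l f x            ≡⟨ cong (_+ countEqual l f x) below ⟨
    countBelow l f x + countEqual l f x ≡⟨ countBelow-suc l f x ⟨
    countBelow l f (suc x)              ≡⟨ below′ ⟩
    suc (toℕ j)                         ≡⟨ +-comm 1 (toℕ j) ⟩
    toℕ j + 1                           ∎)

module _ {g : ℕ → ℕ} (g0≡0 : g 0 ≡ 0) (g-step : ∀ y → g (suc y) ≤ suc (g y)) where

  slowGrowth⇒≤id : ∀ z → g z ≤ z
  slowGrowth⇒≤id zero    = ≤-reflexive g0≡0
  slowGrowth⇒≤id (suc z) = ≤-trans (g-step z) (s≤s (slowGrowth⇒≤id z))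

  slowGrowth⇒fixedBelow : ∀ t {z} → g t ≡ t → z ≤ t → g z ≡ z
  slowGrowth⇒fixedBelow zero    gt≡t z≤n = gt≡t
  slowGrowth⇒fixedBelow (suc t) gt≡t z≤1+t with m≤n⇒m<n∨m≡n z≤1+t
  ... | inj₂ refl  = gt≡t
  ... | inj₁ z<1+t = slowGrowth⇒fixedBelow t gt≡t′ (s≤s⁻¹ z<1+t)
    where
    gt≡t′ : g t ≡ t
    gt≡t′ = ≤-antisym (slowGrowth⇒≤id t) (s≤s⁻¹ (subst (_≤ suc (g t)) gt≡t (g-step t)))

[+m]-[+n]≡+o⇔m≡o+n : ∀ m n o → (+ m ℤ.- + n ≡ + o) ⇔ (m ≡ o + n)
[+m]-[+n]≡+o⇔m≡o+n m n o = mk⇔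
  (λ eq → +-injective (begin
    + m                 ≡⟨ //-rightDividesˡ (+ n) (+ m) ⟨
    + m ℤ.- + n ℤ.+ + n ≡⟨ cong (ℤ._+ + n) eq ⟩
    + o ℤ.+ + n         ≡⟨ pos-+ o n ⟨
    + (o + n)           ∎))
  (λ { refl → trans (cong (ℤ._- + n) (pos-+ o n)) (//-rightDividesʳ (+ n) (+ o)) })
  where open ≡-Reasoning

HasDepths : ∀ {n m m≤n} → SYT n m m≤n → (Fin n → ℕ) → Set
HasDepths T c = ∀ i → dep₁ T (col₁ T i) ≡ + c i

module SYTProperties {n m : ℕ} {m≤n : m ≤ n} (T : SYT n m m≤n) where

  entriesBelow : ℕ → ℕ
  entriesBelow y = countBelow n (col₁ T) y + countBelow m (col₂ T) y

  columnsHit≤1 : ∀ y → countEqual n (col₁ T) y + countEqual m (col₂ T) y ≤ 1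
  columnsHit≤1 y with countEqual m (col₂ T) y in hits₂
  ... | zero  = subst (_≤ 1) (sym (+-identityʳ _)) (countEqual≤1 n (col₁ T) (col₁-incr T) y)
  ... | suc _ with countEqual-witness m (col₂ T) y (subst (0 <_) (sym hits₂) z<s)
  ...   | j , col₂j≡y
    rewrite countEqual≡0 n (col₁ T) y (λ i col₁i≡y → disjoint T i j (trans col₁i≡y (sym col₂j≡y)))
    = subst (_≤ 1) hits₂ (countEqual≤1 m (col₂ T) (col₂-incr T) y)

  entriesBelow-suc≤ : ∀ y → entriesBelow (suc y) ≤ suc (entriesBelow y)
  entriesBelow-suc≤ y = begin
    entriesBelow (suc y)    ≡⟨ cong₂ _+_ (countBelow-suc n (col₁ T) y) (countBelow-suc m (col₂ T) y) ⟩
    (b₁ + e₁) + (b₂ + e₂)   ≡⟨ interchange b₁ e₁ b₂ e₂ ⟩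
    (b₁ + b₂) + (e₁ + e₂)   ≤⟨ +-monoʳ-≤ (b₁ + b₂) (columnsHit≤1 y) ⟩
    (b₁ + b₂) + 1           ≡⟨ +-comm (b₁ + b₂) 1 ⟩
    suc (entriesBelow y)    ∎
    where
    open ≤-Reasoning
    b₁ = countBelow n (col₁ T) y
    b₂ = countBelow m (col₂ T) y
    e₁ = countEqual n (col₁ T) y
    e₂ = countEqual m (col₂ T) y

  entriesBelow-1 : entriesBelow 1 ≡ 0
  entriesBelow-1 = cong₂ _+_
    (n≤0⇒n≡0 (countBelow≤ n (col₁ T) 1 0 (λ i _ → proj₁ (col₁-range T i))))
    (n≤0⇒n≡0 (countBelow≤ m (col₂ T) 1 0 (λ j _ → proj₁ (col₂-range T j))))

  entriesBelow-all : entriesBelow (suc (n + m)) ≡ n + m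
  entriesBelow-all = cong₂ _+_
    (countBelow≡length n (col₁ T) _ (λ i → s≤s (proj₂ (col₁-range T i))))
    (countBelow≡length m (col₂ T) _ (λ j → s≤s (proj₂ (col₂-range T j))))

  -- Distinct entries make the count grow by at most one per step; it rises from 0 to n + m.
  entriesBelow-suc : ∀ {z} → z ≤ n + m → entriesBelow (suc z) ≡ z
  entriesBelow-suc = slowGrowth⇒fixedBelow {g = entriesBelow ∘ suc}
    entriesBelow-1 (entriesBelow-suc≤ ∘ suc) (n + m) entriesBelow-all

  col₂Below : Fin n → ℕ
  col₂Below i = countBelow m (col₂ T) (col₁ T i)

  dep₁-col₁≡⇔ : ∀ i c → (dep₁ T (col₁ T i) ≡ + c) ⇔ (toℕ i ≡ c + col₂Below i)
  dep₁-col₁≡⇔ i c =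
    subst (λ k → (+ k ℤ.- + col₂Below i ≡ + c) ⇔ (toℕ i ≡ c + col₂Below i))
      (sym (countBelow-rank n (col₁ T) (col₁-incr T) i))
      ([+m]-[+n]≡+o⇔m≡o+n (toℕ i) (col₂Below i) c)

  entriesBelow-entry : ∀ {x} → 1 ≤ x → x ≤ n + m → suc (entriesBelow x) ≡ x
  entriesBelow-entry {suc z} _ 1+z≤n+m = cong suc (entriesBelow-suc (<⇒≤ 1+z≤n+m))

  col₁≡ : ∀ i → col₁ T i ≡ suc (toℕ i + col₂Below i)
  col₁≡ i = trans (sym (entriesBelow-entry (proj₁ (col₁-range T i)) (proj₂ (col₁-range T i))))
    (cong (λ k → suc (k + col₂Below i)) (countBelow-rank n (col₁ T) (col₁-incr T) i))

  col₂Below-mono : ∀ i j → toℕ i ≤ toℕ j → col₂Below i ≤ col₂Below j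
  col₂Below-mono i j i≤j =
    countBelow-monoʳ m (col₂ T) (strictlyIncreasing⇒monotone (col₁-incr T) i j i≤j)

  col₂Below≤m : ∀ i → col₂Below i ≤ m
  col₂Below≤m i = countBelow≤length m (col₂ T) (col₁ T i)

module Depths {n m : ℕ} {m≤n : m ≤ n} (T : SYT n m m≤n) (c : Fin n → ℕ) (hT : HasDepths T c) where
  open SYTProperties T

  index≡depth+col₂Below : ∀ i → toℕ i ≡ c i + col₂Below i
  index≡depth+col₂Below i = Equivalence.to (dep₁-col₁≡⇔ i (c i)) (hT i)

  depth-first : ∀ i → toℕ i ≡ 0 → c i ≡ 0
  depth-first i i≡0 = m+n≡0⇒m≡0 (c i) (trans (sym (index≡depth+col₂Below i)) i≡0)

  depth-step : ∀ i j → toℕ j ≡ suc (toℕ i) → c j ≤ suc (c i)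
  depth-step i j j≡1+i = +-cancelʳ-≤ (col₂Below i) (c j) (suc (c i)) (begin
    c j + col₂Below i       ≤⟨ +-monoʳ-≤ (c j) (col₂Below-mono i j i≤j) ⟩
    c j + col₂Below j       ≡⟨ index≡depth+col₂Below j ⟨
    toℕ j                   ≡⟨ j≡1+i ⟩
    suc (toℕ i)             ≡⟨ cong suc (index≡depth+col₂Below i) ⟩
    suc (c i) + col₂Below i ∎)
    where
    open ≤-Reasoning
    i≤j : toℕ i ≤ toℕ j
    i≤j = subst (toℕ i ≤_) (sym j≡1+i) (n≤1+n (toℕ i))

  index∸m≤depth : ∀ i → toℕ i ∸ m ≤ c i
  index∸m≤depth i = m≤n+o⇒m∸n≤o (toℕ i) m (begin
    toℕ i             ≡⟨ index≡depth+col₂Below i ⟩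
    c i + col₂Below i ≤⟨ +-monoʳ-≤ (c i) (col₂Below≤m i) ⟩
    c i + m           ≡⟨ +-comm (c i) m ⟩
    m + c i           ∎)
    where open ≤-Reasoning

open Depths

col₁-determinedBy-depths : ∀ {n m m≤n} (T T′ : SYT n m m≤n) (c : Fin n → ℕ) →
  HasDepths T c → HasDepths T′ c → ∀ i → col₁ T i ≡ col₁ T′ i
col₁-determinedBy-depths T T′ c hT hT′ i = begin
  col₁ T i                                  ≡⟨ SYTProperties.col₁≡ T i ⟩
  suc (toℕ i + SYTProperties.col₂Below T i)  ≡⟨ cong (λ k → suc (toℕ i + k)) sameCol₂Below ⟩
  suc (toℕ i + SYTProperties.col₂Below T′ i) ≡⟨ SYTProperties.col₁≡ T′ i ⟨
  col₁ T′ i                                 ∎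
  where
  open ≡-Reasoning
  sameCol₂Below : SYTProperties.col₂Below T i ≡ SYTProperties.col₂Below T′ i
  sameCol₂Below = +-cancelˡ-≡ (c i) _ _
    (trans (sym (index≡depth+col₂Below T c hT i)) (index≡depth+col₂Below T′ c hT′ i))

col₂-determinedBy-col₁ : ∀ {n m m≤n} (T T′ : SYT n m m≤n) →
  (∀ i → col₁ T i ≡ col₁ T′ i) → ∀ j → col₂ T j ≡ col₂ T′ j
col₂-determinedBy-col₁ {n} {m} T T′ sameCol₁ j = sym (rank⇒≡ m (col₂ T′) (col₂-incr T′) j x
  (trans (sameBelow (proj₁ x-range) (m≤n⇒m≤1+n (proj₂ x-range))) (countBelow-rank m (col₂ T) (col₂-incr T) j))
  (trans (sameBelow (s≤s z≤n) (s≤s (proj₂ x-range))) (countBelow-suc-rank m (col₂ T) (col₂-incr T) j)))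
  where
  x = col₂ T j
  x-range = col₂-range T j
  open SYTProperties using (entriesBelow; entriesBelow-suc)
  sameBelow : ∀ {y} → 1 ≤ y → y ≤ suc (n + m) → countBelow m (col₂ T′) y ≡ countBelow m (col₂ T) y
  sameBelow {suc z} _ (s≤s z≤n+m) = +-cancelˡ-≡ (countBelow n (col₁ T) (suc z)) _ _ (begin
    countBelow n (col₁ T) (suc z) + countBelow m (col₂ T′) (suc z)
      ≡⟨ cong (_+ countBelow m (col₂ T′) (suc z)) (countBelow-cong n (suc z) sameCol₁) ⟩
    entriesBelow T′ (suc z) ≡⟨ entriesBelow-suc T′ z≤n+m ⟩
    z                       ≡⟨ entriesBelow-suc T z≤n+m ⟨
    entriesBelow T (suc z)  ∎)
    where open ≡-Reasoning

module Construction {n m : ℕ} (m≤n : m ≤ n) (s : Fin n → ℕ)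
  (s-mono : ∀ i j → toℕ i ≤ toℕ j → s i ≤ s j)
  (s≤index : ∀ i → s i ≤ toℕ i) (s≤m : ∀ i → s i ≤ m) where

  countAtMost : ℕ → ℕ
  countAtMost t = countBelow n s (suc t)

  first : Fin n → ℕ
  first i = suc (toℕ i + s i)

  second : Fin m → ℕ
  second j = suc (toℕ j + countAtMost (toℕ j))

  second<first : ∀ i j → toℕ j < s i → second j < first i
  second<first i j j<sᵢ =
    s≤s (subst (toℕ j + countAtMost (toℕ j) <_) (+-comm (s i) (toℕ i)) (+-mono-<-≤ j<sᵢ fewAtMost))
    where
    fewAtMost : countAtMost (toℕ j) ≤ toℕ i
    fewAtMost = countBelow≤ n s (suc (toℕ j)) (toℕ i) (λ k i≤k → ≤-trans j<sᵢ (s-mono i k i≤k))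

  first<second : ∀ i j → s i ≤ toℕ j → first i < second j
  first<second i j sᵢ≤j =
    s≤s (subst (toℕ i + s i <_) (+-comm (countAtMost (toℕ j)) (toℕ j)) (+-mono-<-≤ manyAtMost sᵢ≤j))
    where
    manyAtMost : suc (toℕ i) ≤ countAtMost (toℕ j)
    manyAtMost = ≤countBelow n s (suc (toℕ j)) (suc (toℕ i)) (toℕ<n i)
      (λ k k<1+i → s≤s (≤-trans (s-mono k i (s≤s⁻¹ k<1+i)) sᵢ≤j))

  tableau : SYT n m m≤n
  tableau = record
    { col₁       = first
    ; col₂       = second
    ; col₁-range = λ i → s≤s z≤n , +-mono-≤ (toℕ<n i) (s≤m i)
    ; col₂-range = λ j → s≤s z≤n ,
        subst (second j ≤_) (+-comm m n) (+-mono-≤ (toℕ<n j) (countBelow≤length n s _))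
    ; col₁-incr  = λ i i′ i<i′ → s≤s (+-mono-<-≤ i<i′ (s-mono i i′ (<⇒≤ i<i′)))
    ; col₂-incr  = λ j j′ j<j′ → s≤s (+-mono-<-≤ j<j′ (countBelow-monoʳ n s (s≤s (<⇒≤ j<j′))))
    ; rows-incr  = λ j → first<second (inject≤ j m≤n) j
        (subst (s (inject≤ j m≤n) ≤_) (toℕ-inject≤ j m≤n) (s≤index (inject≤ j m≤n)))
    ; disjoint   = disjoint′
    }
    where
    disjoint′ : ∀ i j → first i ≢ second j
    disjoint′ i j eq with toℕ j <? s i
    ... | yes j<sᵢ = <-irrefl (sym eq) (second<first i j j<sᵢ)
    ... | no  j≮sᵢ = <-irrefl eq (first<second i j (≮⇒≥ j≮sᵢ))

  col₂Below-tableau : ∀ i → SYTProperties.col₂Below tableau i ≡ s i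
  col₂Below-tableau i = countBelow≡ m second (first i) (s i) (s≤m i)
    (second<first i) (λ j sᵢ≤j → <⇒≤ (first<second i j sᵢ≤j))

module Realisation {n m : ℕ} (m≤n : m ≤ n) (c : Fin n → ℕ)
  (c-first : ∀ i → toℕ i ≡ 0 → c i ≡ 0)
  (c-step : ∀ i j → toℕ j ≡ suc (toℕ i) → c j ≤ suc (c i))
  (c-lower : ∀ i → m ≤ toℕ i → toℕ i ∸ m ≤ c i) where

  depth≤index : ∀ i → c i ≤ toℕ i
  depth≤index = consecutive-induction (λ i → c i ≤ toℕ i)
    (λ i i≡0 → ≤-reflexive (trans (c-first i i≡0) (sym i≡0)))
    (λ i j j≡1+i cᵢ≤i → ≤-trans (c-step i j j≡1+i) (subst (suc (c i) ≤_) (sym j≡1+i) (s≤s cᵢ≤i)))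

  s : Fin n → ℕ
  s i = toℕ i ∸ c i

  s-mono : ∀ i j → toℕ i ≤ toℕ j → s i ≤ s j
  s-mono = consecutive-mono⇒mono s λ i j j≡1+i →
    subst (λ k → s i ≤ k ∸ c j) (sym j≡1+i) (∸-monoʳ-≤ (suc (toℕ i)) (c-step i j j≡1+i))

  s≤index : ∀ i → s i ≤ toℕ i
  s≤index i = m∸n≤m (toℕ i) (c i)

  s≤m : ∀ i → s i ≤ m
  s≤m i with m ≤? toℕ i
  ... | yes m≤i = m≤n+o⇒m∸n≤o (toℕ i) (c i) (begin
    toℕ i           ≤⟨ m≤n+m∸n (toℕ i) m ⟩
    m + (toℕ i ∸ m) ≤⟨ +-monoʳ-≤ m (c-lower i m≤i) ⟩
    m + c i         ≡⟨ +-comm m (c i) ⟩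
    c i + m         ∎)
    where open ≤-Reasoning
  ... | no  m≰i = ≤-trans (s≤index i) (<⇒≤ (≰⇒> m≰i))

  open Construction m≤n s s-mono s≤index s≤m public using (tableau; col₂Below-tableau)

  tableau-depths : HasDepths tableau c
  tableau-depths i = Equivalence.from (SYTProperties.dep₁-col₁≡⇔ tableau i (c i))
    (trans (sym (m+[n∸m]≡n (depth≤index i))) (cong (λ k → c i + k) (sym (col₂Below-tableau i))))

open Realisation

mainTheorem17 : (n m : ℕ) (m≤n : m ≤ n) (c : Fin n → ℕ) →
    ((∃ λ (T : SYT n m m≤n) → ∀ i → dep₁ T (col₁ T i) ≡ + c i)
      ⇔ ((∀ i → toℕ i ≡ 0 → c i ≡ 0)
         × (∀ i j → toℕ j ≡ suc (toℕ i) → c j ≤ suc (c i))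
         × (∀ i → m ≤ toℕ i → toℕ i ∸ m ≤ c i)))
    × (∀ (T T′ : SYT n m m≤n)
         → (∀ i → dep₁ T (col₁ T i) ≡ + c i)
         → (∀ i → dep₁ T′ (col₁ T′ i) ≡ + c i)
         → (∀ i → col₁ T i ≡ col₁ T′ i) × (∀ j → col₂ T j ≡ col₂ T′ j))
mainTheorem17 n m m≤n c =
  mk⇔ (λ (T , hT) → depth-first T c hT , depth-step T c hT , λ i _ → index∸m≤depth T c hT i)
      (λ (c-first , c-step , c-lower) →
        tableau m≤n c c-first c-step c-lower , tableau-depths m≤n c c-first c-step c-lower)
  , λ T T′ hT hT′ → let sameCol₁ = col₁-determinedBy-depths T T′ c hT hT′
                     in sameCol₁ , col₂-determinedBy-col₁ T T′ sameCol₁
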